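{- Let $R$ be a commutative ring, $G$ a subgroup of $\mathrm{GL}_2(\mathbb{Q})$, $e=(1:0)$, and $\mathcal C$ a set of representatives of the $G$-orbits in $\mathbb{P}^1(\mathbb{Q})$ containing $e$. Let $W$ be the $R$-span of the symbols $[e,c]_G$, $c\in\mathcal C$, and $V$ the $R$-span of the symbols $[e,ge]_G$, $g\in G$. Then $$H_0(G,\mathrm{St}(\mathbb{Q}^2;R))=H_0^{\mathrm{cusp}}(G,\mathrm{St}(\mathbb{Q}^2;R))\oplus W\quad\text{and}\quad H_0^{\mathrm{cusp}}(G,\mathrm{St}(\mathbb{Q}^2;R))=V.$$
   Context: $\mathrm{St}(\mathbb{Q}^2;R)=\tilde H_0(\mathbb{P}^1(\mathbb{Q});R)$, generated by modular symbols $[v,w]$ (fundamental class of $\{v,w\}$ with boundary $w-v$), $g[v,w]=[gv,gw]$; $[v,w]_G$ is the image in $H_0(G,\mathrm{St}(\mathbb{Q}^2;R))$. $H_0^{\mathrm{cusp}}(G,\mathrm{St}(\mathbb{Q}^2;R))$ is the kernel of the map $H_0(G,\mathrm{St}(\mathbb{Q}^2;R))\to H_0(G,\mathcal D(R))$ induced by $[u,v]\mapsto(v)-(u)$, where $\mathcal D(R)$ is the module of $R$-divisors on $\mathbb{P}^1(\mathbb{Q})$. -}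

module Defs where

open import Level using (Level; _⊔_; 0ℓ)
open import Data.Rational using (ℚ; 0ℚ; 1ℚ; _+_; _*_; _-_; _÷_; ≢-nonZero)
open import Data.Rational.Properties using (_≟_)
open import Data.Unit using (⊤; tt)
open import Data.Sum using (_⊎_; inj₁; inj₂)
open import Data.Product using (Σ; ∃; _×_; _,_; proj₁; proj₂)
open import Data.List using (List; []; _∷_; _++_; map)
open import Data.List.Relation.Unary.All using (All)
open import Relation.Binary.PropositionalEquality using (_≡_; _≢_)
open import Relation.Nullary using (yes; no)
open import Relation.Binary.Definitions using (DecidableEquality)
import Data.Sum.Properties as SumP
open import Algebra.Bundles using (CommutativeRing)

-- P¹(ℚ):  inj₁ q  is the point (q : 1),  inj₂ tt  is the point (1 : 0) = ∞.

P1 : Set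
P1 = ℚ ⊎ ⊤

_≟P_ : DecidableEquality P1
_≟P_ = SumP.≡-dec _≟_ (λ { tt tt → yes Relation.Binary.PropositionalEquality.refl })

e : P1
e = inj₂ tt

-- the point (x : y) of P¹(ℚ) for a nonzero vector (x , y)  (if y = 0 it is (1:0))
proj : ℚ → ℚ → P1
proj x y with y ≟ 0ℚ
... | yes _  = inj₂ tt
... | no y≢0 = inj₁ (_÷_ x y {{≢-nonZero y≢0}})

record Mat2 : Set where
  constructor mat
  field a b c d : ℚ
open Mat2 public

det : Mat2 → ℚ
det m = a m * d m - b m * c m

_·ₘ_ : Mat2 → Mat2 → Mat2
m ·ₘ n = mat (a m * a n + b m * c n) (a m * b n + b m * d n)
             (c m * a n + d m * c n) (c m * b n + d m * d n)

I₂ : Mat2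
I₂ = mat 1ℚ 0ℚ 0ℚ 1ℚ

record IsSubgroupGL2 (G : Mat2 → Set) : Set where
  field
    invertible : ∀ {g} → G g → det g ≢ 0ℚ
    has-id     : G I₂
    closed-mul : ∀ {g h} → G g → G h → G (g ·ₘ h)
    has-inv    : ∀ {g} → G g → Σ Mat2 λ h → G h × (g ·ₘ h ≡ I₂)

act : Mat2 → P1 → P1
act m (inj₁ q)  = proj (a m * q + b m) (c m * q + d m)
act m (inj₂ tt) = proj (a m) (c m)

_∼[_]_ : P1 → (Mat2 → Set) → P1 → Set
x ∼[ G ] y = Σ Mat2 λ g → G g × act g x ≡ y

record IsOrbitReps (G : Mat2 → Set) (C : P1 → Set) : Set where
  field
    contains-e : C e
    covers     : ∀ x → Σ P1 λ c → C c × (x ∼[ G ] c)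
    unique     : ∀ {c c′} → C c → C c′ → c ∼[ G ] c′ → c ≡ c′

module Over {c ℓ : Level} (R : CommutativeRing c ℓ) where
  open CommutativeRing R renaming (Carrier to A; _+_ to _+R_; _*_ to _*R_)

  -- 𝒟(R): finitely supported R-valued functions on P¹(ℚ), presented as
  -- formal sums Σ r (p); two presentations are identified when all
  -- coefficients agree (see _≈D_).
  Div : Set c
  Div = List (P1 × A)

  coeff : Div → P1 → A
  coeff []            p = 0#
  coeff ((q , r) ∷ d) p with q ≟P p
  ... | yes _ = r +R coeff d p
  ... | no _  = coeff d p

  _≈D_ : Div → Div → Set ℓ
  d ≈D d′ = ∀ p → coeff d p ≈ coeff d′ p

  -- degree (augmentation)  𝒟(R) → R ;  St(ℚ²;R) = its kernel = H̃₀(P¹(ℚ);R)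
  deg : Div → A
  deg []            = 0#
  deg ((_ , r) ∷ d) = r +R deg d

  InSt : Div → Set ℓ
  InSt d = deg d ≈ 0#

  negD : Div → Div
  negD = map (λ { (p , r) → (p , - r) })

  _-D_ : Div → Div → Div
  d -D d′ = d ++ negD d′

  scaleD : A → Div → Div
  scaleD s = map (λ { (p , r) → (p , s *R r) })

  actD : Mat2 → Div → Div
  actD g = map (λ { (p , r) → (act g p , r) })

  [_,_] : P1 → P1 → Div
  [ v , w ] = (w , 1#) ∷ (v , - 1#) ∷ []

  relSum : List (Mat2 × Div) → Div
  relSum []            = []
  relSum ((g , m) ∷ l) = (actD g m -D m) ++ relSum l

  -- equality in H₀(G, St(ℚ²;R)) = St / ⟨ g m − m : g ∈ G, m ∈ St ⟩
  -- (for elements x, y of St)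
  _≡St[_]_ : Div → (Mat2 → Set) → Div → Set (c ⊔ ℓ)
  x ≡St[ G ] y = Σ (List (Mat2 × Div)) λ l →
                   All (λ gm → G (proj₁ gm) × InSt (proj₂ gm)) l
                 × ((x -D y) ≈D relSum l)

  -- equality in H₀(G, 𝒟(R)) = 𝒟 / ⟨ g m − m : g ∈ G, m ∈ 𝒟 ⟩
  _≡D[_]_ : Div → (Mat2 → Set) → Div → Set (c ⊔ ℓ)
  x ≡D[ G ] y = Σ (List (Mat2 × Div)) λ l →
                  All (λ gm → G (proj₁ gm)) l
                × ((x -D y) ≈D relSum l)

  -- x ∈ St represents a class in H₀^cusp(G,St): its image under the map
  -- H₀(G,St) → H₀(G,𝒟) induced by the inclusion St ⊆ 𝒟 ([u,v] ↦ (v)−(u)) is 0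
  Cusp : (Mat2 → Set) → Div → Set (c ⊔ ℓ)
  Cusp G x = x ≡D[ G ] []

  spanW : List (A × P1) → Div
  spanW []            = []
  spanW ((r , p) ∷ l) = scaleD r [ e , p ] ++ spanW l

  spanV : List (A × Mat2) → Div
  spanV []            = []
  spanV ((r , g) ∷ l) = scaleD r [ e , act g e ] ++ spanV l

{-# OPTIONS --safe #-}
module Submission where

open import Defs
open import Level using (Level; _⊔_)
open import Algebra.Bundles using (CommutativeRing)
open import Data.Product using (Σ; _×_; _,_; proj₁; proj₂)
open import Data.List using (List; []; _∷_; _++_; map; length)
import Data.List.Properties as List
open import Data.List.Relation.Unary.All as All using (All; []; _∷_)
import Data.List.Relation.Unary.All.Properties as All
open import Function.Bundles using (_⇔_; mk⇔)
open import Function.Base using (_∘_; id)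
open import Data.Integer.Base as ℤ using (ℤ; +_; -[1+_]; _⊖_)
import Data.Integer.Properties as ℤ
open import Data.Nat.Base as ℕ using (zero; suc; _≤_; z≤n; s≤s)
import Data.Nat.Properties as ℕ
open import Data.Maybe.Base using (Maybe; just; nothing)
open import Data.Empty using (⊥-elim)
open import Relation.Nullary using (yes; no; ¬_)
import Relation.Binary.PropositionalEquality as ≡
open ≡ using (_≡_; _≢_)

-- Write x = Σ rᵢ (qᵢ) ∈ St and pick gᵢ ∈ G moving qᵢ to its representative cᵢ ∈ 𝒞.
-- Modulo the relations gᵢ mᵢ − mᵢ with mᵢ = −rᵢ [e, qᵢ] ∈ St, and since Σ rᵢ = 0,
--   x ≡ Σ (−rᵢ) [e, gᵢ e] + Σ rᵢ [e, cᵢ],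
-- the first sum lying in V and the second in W. Each [e, g e] = g (e) − (e) vanishes in
-- H₀(G, 𝒟), so V ⊆ H₀^cusp. Conversely, for f : P¹(ℚ) → R the pairing d ↦ Σ r f(rep p)
-- kills all relations of H₀(G, 𝒟) and agrees with d ↦ Σ r f(p) on W; hence a cuspidal
-- element of W has all coefficients 0. This gives H₀ = H₀^cusp ⊕ W, and a cuspidal x is
-- congruent to its V-part.

-- Algebra.Solver.Ring with integer coefficients mapped into R: with coefficients taken in
-- an arbitrary ring the normal forms are not canonical.
module IntegerCoefficientRingSolver {c ℓ} (R : CommutativeRing c ℓ) where

  open CommutativeRing R
  open import Algebra.Properties.Ring ring using (-‿distribˡ-*; -‿distribʳ-*; -‿involutive; -0#≈0#; -‿+-comm)
  open import Algebra.Properties.Semiring.Mult.TCOptimised semiring using (1+×; ×-homo-+; ×1-homo-*) renaming (_×_ to _·_)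
  open import Algebra.Solver.Ring.AlmostCommutativeRing
    using (AlmostCommutativeRing; fromCommutativeRing; _-Raw-AlmostCommutative⟶_)
  open import Relation.Binary.Reasoning.Setoid setoid

  ⟦_⟧ℤ : ℤ → Carrier
  ⟦ + n ⟧ℤ     = n · 1#
  ⟦ -[1+ n ] ⟧ℤ = - (suc n · 1#)

  private
    cancel-+ : ∀ x a b → (x + a) + - (x + b) ≈ a + - b
    cancel-+ x a b = begin
      (x + a) + - (x + b)     ≈⟨ +-congˡ (-‿+-comm x b) ⟨
      (x + a) + (- x + - b)   ≈⟨ +-assoc x a (- x + - b) ⟩
      x + (a + (- x + - b))   ≈⟨ +-congˡ (+-congˡ (+-comm (- x) (- b))) ⟩
      x + (a + (- b + - x))   ≈⟨ +-congˡ (+-assoc a (- b) (- x)) ⟨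
      x + ((a + - b) + - x)   ≈⟨ +-comm x _ ⟩
      ((a + - b) + - x) + x   ≈⟨ +-assoc (a + - b) (- x) x ⟩
      (a + - b) + (- x + x)   ≈⟨ +-congˡ (-‿inverseˡ x) ⟩
      (a + - b) + 0#          ≈⟨ +-identityʳ (a + - b) ⟩
      a + - b                 ∎

    -x*-y≈x*y : ∀ x y → - x * - y ≈ x * y
    -x*-y≈x*y x y = begin
      - x * - y     ≈⟨ -‿distribʳ-* (- x) y ⟨
      - (- x * y)   ≈⟨ -‿cong (-‿distribˡ-* x y) ⟨
      - - (x * y)   ≈⟨ -‿involutive (x * y) ⟩
      x * y         ∎

  ⊖-homo : ∀ m n → ⟦ m ⊖ n ⟧ℤ ≈ m · 1# + - (n · 1#)
  ⊖-homo m       zero    = sym (trans (+-congˡ -0#≈0#) (+-identityʳ _))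
  ⊖-homo zero    (suc n) = sym (+-identityˡ _)
  ⊖-homo (suc m) (suc n) = begin
    ⟦ suc m ⊖ suc n ⟧ℤ              ≡⟨ ≡.cong ⟦_⟧ℤ (ℤ.[1+m]⊖[1+n]≡m⊖n m n) ⟩
    ⟦ m ⊖ n ⟧ℤ                      ≈⟨ ⊖-homo m n ⟩
    m · 1# + - (n · 1#)             ≈⟨ cancel-+ 1# _ _ ⟨
    (1# + m · 1#) + - (1# + n · 1#) ≈⟨ +-cong (1+× m 1#) (-‿cong (1+× n 1#)) ⟨
    suc m · 1# + - (suc n · 1#)     ∎

  +-homo : ∀ i j → ⟦ i ℤ.+ j ⟧ℤ ≈ ⟦ i ⟧ℤ + ⟦ j ⟧ℤ
  +-homo (+ m)     (+ n)     = ×-homo-+ 1# m n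
  +-homo (+ m)     -[1+ n ]  = ⊖-homo m (suc n)
  +-homo -[1+ m ]  (+ n)     = trans (⊖-homo n (suc m)) (+-comm _ _)
  +-homo -[1+ m ]  -[1+ n ]  = begin
    - (suc (suc (m ℕ.+ n)) · 1#)        ≡⟨ ≡.cong (λ k → - (suc k · 1#)) (ℕ.+-suc m n) ⟨
    - ((suc m ℕ.+ suc n) · 1#)          ≈⟨ -‿cong (×-homo-+ 1# (suc m) (suc n)) ⟩
    - (suc m · 1# + suc n · 1#)         ≈⟨ -‿+-comm _ _ ⟨
    - (suc m · 1#) + - (suc n · 1#)     ∎

  private
    *-homo-+- : ∀ m n → ⟦ + m ℤ.* -[1+ n ] ⟧ℤ ≈ ⟦ + m ⟧ℤ * ⟦ -[1+ n ] ⟧ℤ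
    *-homo-+- zero    n = sym (zeroˡ _)
    *-homo-+- (suc m) n = trans (-‿cong (×1-homo-* (suc m) (suc n))) (-‿distribʳ-* _ _)

  *-homo : ∀ i j → ⟦ i ℤ.* j ⟧ℤ ≈ ⟦ i ⟧ℤ * ⟦ j ⟧ℤ
  *-homo (+ m)     (+ n)     = trans (reflexive (≡.cong ⟦_⟧ℤ (ℤ.+◃n≡+n (m ℕ.* n)))) (×1-homo-* m n)
  *-homo (+ m)     -[1+ n ]  = *-homo-+- m n
  *-homo -[1+ m ]  (+ n)     = begin
    ⟦ -[1+ m ] ℤ.* + n ⟧ℤ    ≡⟨ ≡.cong ⟦_⟧ℤ (ℤ.*-comm -[1+ m ] (+ n)) ⟩
    ⟦ + n ℤ.* -[1+ m ] ⟧ℤ    ≈⟨ *-homo-+- n m ⟩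
    ⟦ + n ⟧ℤ * ⟦ -[1+ m ] ⟧ℤ ≈⟨ *-comm _ _ ⟩
    ⟦ -[1+ m ] ⟧ℤ * ⟦ + n ⟧ℤ ∎
  *-homo -[1+ m ]  -[1+ n ]  = trans (×1-homo-* (suc m) (suc n)) (sym (-x*-y≈x*y _ _))

  neg-homo : ∀ i → ⟦ ℤ.- i ⟧ℤ ≈ - ⟦ i ⟧ℤ
  neg-homo (+ zero)  = sym -0#≈0#
  neg-homo (+ suc n) = refl
  neg-homo -[1+ n ]  = sym (-‿involutive _)

  private
    almostCommutativeRing : AlmostCommutativeRing c ℓ
    almostCommutativeRing = fromCommutativeRing R

    ℤ⟶R : ℤ.+-*-rawRing -Raw-AlmostCommutative⟶ almostCommutativeRing
    ℤ⟶R = record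
      { ⟦_⟧ = ⟦_⟧ℤ ; +-homo = +-homo ; *-homo = *-homo ; -‿homo = neg-homo
      ; 0-homo = refl ; 1-homo = refl }

    ⟦⟧ℤ-≟ : ∀ i j → Maybe (⟦ i ⟧ℤ ≈ ⟦ j ⟧ℤ)
    ⟦⟧ℤ-≟ i j with i ℤ.≟ j
    ... | yes ≡.refl = just refl
    ... | no _       = nothing

  open import Algebra.Solver.Ring ℤ.+-*-rawRing almostCommutativeRing ℤ⟶R ⟦⟧ℤ-≟ public

module ProjectiveLine where

  open import Data.Rational using (ℚ; 0ℚ; 1ℚ; _+_; _*_; _-_; _÷_; ≢-nonZero; 1/_)
  open import Data.Rational.Properties using (_≟_; *-assoc; *-identityʳ; *-identityˡ; *-inverseʳ; *-inverseˡ; *-zeroʳ)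
  open import Data.Rational.Solver using (module +-*-Solver)
  open import Data.Unit using (tt)
  open import Data.Sum using (inj₁; inj₂)
  open ≡ using (refl; sym; trans; cong; cong₂; module ≡-Reasoning)
  open +-*-Solver

  private
    ÷-unique : ∀ x y z (y≢0 : y ≢ 0ℚ) → z * y ≡ x → (x ÷ y) {{≢-nonZero y≢0}} ≡ z
    ÷-unique x y z y≢0 refl = begin
      z * y * 1/ y     ≡⟨ *-assoc z y (1/ y) ⟩
      z * (y * 1/ y)   ≡⟨ cong (z *_) (*-inverseʳ y) ⟩
      z * 1ℚ           ≡⟨ *-identityʳ z ⟩
      z                ∎
      where open ≡-Reasoning
            instance _ = ≢-nonZero y≢0

    ÷-*-cancel : ∀ x y (y≢0 : y ≢ 0ℚ) → (x ÷ y) {{≢-nonZero y≢0}} * y ≡ x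
    ÷-*-cancel x y y≢0 = begin
      x * 1/ y * y     ≡⟨ *-assoc x (1/ y) y ⟩
      x * (1/ y * y)   ≡⟨ cong (x *_) (*-inverseˡ y) ⟩
      x * 1ℚ           ≡⟨ *-identityʳ x ⟩
      x                ∎
      where open ≡-Reasoning
            instance _ = ≢-nonZero y≢0

    *-nonzero : ∀ x y → x ≢ 0ℚ → y ≢ 0ℚ → x * y ≢ 0ℚ
    *-nonzero x y x≢0 y≢0 xy≡0 = y≢0 (begin
      y                 ≡⟨ *-identityˡ y ⟨
      1ℚ * y            ≡⟨ cong (_* y) (*-inverseˡ x) ⟨
      1/ x * x * y      ≡⟨ *-assoc (1/ x) x y ⟩
      1/ x * (x * y)    ≡⟨ cong (1/ x *_) xy≡0 ⟩
      1/ x * 0ℚ         ≡⟨ *-zeroʳ (1/ x) ⟩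
      0ℚ                ∎)
      where open ≡-Reasoning
            instance _ = ≢-nonZero x≢0

  NonZeroVec : ℚ → ℚ → Set
  NonZeroVec x y = ¬ (x ≡ 0ℚ × y ≡ 0ℚ)

  proj-scale : ∀ k x y → k ≢ 0ℚ → proj (k * x) (k * y) ≡ proj x y
  proj-scale k x y k≢0 with y ≟ 0ℚ | k * y ≟ 0ℚ
  ... | yes _   | yes _    = refl
  ... | yes y≡0 | no ly≢0  = ⊥-elim (ly≢0 (trans (cong (k *_) y≡0) (*-zeroʳ k)))
  ... | no y≢0  | yes ly≡0 = ⊥-elim (*-nonzero k y k≢0 y≢0 ly≡0)
  ... | no y≢0  | no ly≢0  = cong inj₁ (÷-unique (k * x) (k * y) _ ly≢0 (begin
      x÷y * (k * y)   ≡⟨ solve 3 (λ q k y → q :* (k :* y) := k :* (q :* y)) refl x÷y k y ⟩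
      k * (x÷y * y)   ≡⟨ cong (k *_) (÷-*-cancel x y y≢0) ⟩
      k * x           ∎))
    where open ≡-Reasoning
          x÷y = (x ÷ y) {{≢-nonZero y≢0}}

  act-proj : ∀ m x y → NonZeroVec x y → act m (proj x y) ≡ proj (a m * x + b m * y) (c m * x + d m * y)
  act-proj m x y xy≢0 with y ≟ 0ℚ
  ... | yes y≡0 = sym (trans (cong₂ proj (lin (a m) (b m)) (lin (c m) (d m))) (proj-scale x (a m) (c m) x≢0))
    where
    x≢0 : x ≢ 0ℚ
    x≢0 x≡0 = xy≢0 (x≡0 , y≡0)
    lin : ∀ s t → s * x + t * y ≡ x * s
    lin s t rewrite y≡0 = solve 3 (λ s t x → s :* x :+ t :* con 0ℚ := x :* s) refl s t x
  ... | no y≢0 = sym (trans (cong₂ proj (lin (a m) (b m)) (lin (c m) (d m))) (proj-scale y _ _ y≢0))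
    where
    x÷y = (x ÷ y) {{≢-nonZero y≢0}}
    lin : ∀ s t → s * x + t * y ≡ y * (s * x÷y + t)
    lin s t = begin
      s * x + t * y               ≡⟨ cong (λ u → s * u + t * y) (÷-*-cancel x y y≢0) ⟨
      s * (x÷y * y) + t * y       ≡⟨ solve 4 (λ s t q y → s :* (q :* y) :+ t :* y := y :* (s :* q :+ t)) refl s t x÷y y ⟩
      y * (s * x÷y + t)           ∎
      where open ≡-Reasoning

  det≢0⇒nonZeroVec : ∀ m q → det m ≢ 0ℚ → NonZeroVec (a m * q + b m) (c m * q + d m)
  det≢0⇒nonZeroVec m q det≢0 (u≡0 , v≡0) = det≢0 (begin
    a m * d m - b m * c m                             ≡⟨ solve 5 (λ a b c d q → a :* d :- b :* c := a :* (c :* q :+ d) :- c :* (a :* q :+ b)) refl (a m) (b m) (c m) (d m) q ⟩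
    a m * (c m * q + d m) - c m * (a m * q + b m)     ≡⟨ cong₂ (λ v u → a m * v - c m * u) v≡0 u≡0 ⟩
    a m * 0ℚ - c m * 0ℚ                               ≡⟨ solve 2 (λ a c → a :* con 0ℚ :- c :* con 0ℚ := con 0ℚ) refl (a m) (c m) ⟩
    0ℚ                                                ∎)
    where open ≡-Reasoning

  det≢0⇒nonZeroColumn : ∀ m → det m ≢ 0ℚ → NonZeroVec (a m) (c m)
  det≢0⇒nonZeroColumn m det≢0 (a≡0 , c≡0) = det≢0 (begin
    a m * d m - b m * c m   ≡⟨ cong₂ (λ s t → s * d m - b m * t) a≡0 c≡0 ⟩
    0ℚ * d m - b m * 0ℚ     ≡⟨ solve 2 (λ d b → con 0ℚ :* d :- b :* con 0ℚ := con 0ℚ) refl (d m) (b m) ⟩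
    0ℚ                      ∎)
    where open ≡-Reasoning

  act-·ₘ : ∀ m n p → det n ≢ 0ℚ → act (m ·ₘ n) p ≡ act m (act n p)
  act-·ₘ m n (inj₁ q) det≢0 = sym (trans (act-proj m _ _ (det≢0⇒nonZeroVec n q det≢0)) (cong₂ proj
    (solve 7 (λ a b a′ b′ c′ d′ q → a :* (a′ :* q :+ b′) :+ b :* (c′ :* q :+ d′) := (a :* a′ :+ b :* c′) :* q :+ (a :* b′ :+ b :* d′)) refl (a m) (b m) (a n) (b n) (c n) (d n) q)
    (solve 7 (λ c d a′ b′ c′ d′ q → c :* (a′ :* q :+ b′) :+ d :* (c′ :* q :+ d′) := (c :* a′ :+ d :* c′) :* q :+ (c :* b′ :+ d :* d′)) refl (c m) (d m) (a n) (b n) (c n) (d n) q)))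
  act-·ₘ m n (inj₂ tt) det≢0 = sym (act-proj m _ _ (det≢0⇒nonZeroColumn n det≢0))

  act-I₂ : ∀ p → act I₂ p ≡ p
  act-I₂ (inj₁ q) = trans (cong₂ proj (solve 1 (λ q → con 1ℚ :* q :+ con 0ℚ := q) refl q) (solve 1 (λ q → con 0ℚ :* q :+ con 1ℚ := con 1ℚ) refl q))
                          (cong inj₁ (÷-unique q 1ℚ q (λ ()) (*-identityʳ q)))
  act-I₂ (inj₂ tt) = refl

open ProjectiveLine

module SubgroupAction {G : Mat2 → Set} (G≤GL₂ : IsSubgroupGL2 G) where
  open ≡ using (refl; sym; trans; cong; module ≡-Reasoning)
  open IsSubgroupGL2 G≤GL₂

  act-cancelʳ : ∀ {g h} → G h → g ·ₘ h ≡ I₂ → ∀ p → act g (act h p) ≡ p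
  act-cancelʳ {g} {h} h∈G gh≡I p = begin
    act g (act h p)   ≡⟨ act-·ₘ g h p (invertible h∈G) ⟨
    act (g ·ₘ h) p    ≡⟨ cong (λ m → act m p) gh≡I ⟩
    act I₂ p          ≡⟨ act-I₂ p ⟩
    p                 ∎
    where open ≡-Reasoning

  -- the inverse h of g is only known to be a right inverse; it is a left
  -- inverse on P¹ because h itself has a right inverse k, which acts as g
  act-inverse : ∀ {g} → G g → Σ Mat2 λ h → G h × (∀ p → act h (act g p) ≡ p)
  act-inverse {g} g∈G with has-inv g∈G
  ... | h , h∈G , gh≡I with has-inv h∈G
  ...   | k , k∈G , hk≡I = h , h∈G , λ p → trans (cong (act h) (g≗k p)) (act-cancelʳ k∈G hk≡I p)
    where
    g≗k : ∀ p → act g p ≡ act k p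
    g≗k p = trans (cong (act g) (sym (act-cancelʳ k∈G hk≡I p))) (act-cancelʳ h∈G gh≡I (act k p))

  ∼-sym : ∀ {p q} → p ∼[ G ] q → q ∼[ G ] p
  ∼-sym {p} (g , g∈G , refl) with act-inverse g∈G
  ... | h , h∈G , hg≗id = h , h∈G , hg≗id p

  ∼-trans : ∀ {p q r} → p ∼[ G ] q → q ∼[ G ] r → p ∼[ G ] r
  ∼-trans {p} (g , g∈G , refl) (h , h∈G , refl) = h ·ₘ g , closed-mul h∈G g∈G , act-·ₘ h g p (invertible g∈G)

  module Representatives {C : P1 → Set} (C-reps : IsOrbitReps G C) where
    open IsOrbitReps C-reps

    rep : P1 → P1
    rep p = proj₁ (covers p)

    rep∈C : ∀ p → C (rep p)
    rep∈C p = proj₁ (proj₂ (covers p))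

    ∼rep : ∀ p → p ∼[ G ] rep p
    ∼rep p = proj₂ (proj₂ (covers p))

    rep-resp : ∀ {p q} → p ∼[ G ] q → rep p ≡ rep q
    rep-resp {p} {q} p∼q = unique (rep∈C p) (rep∈C q)
      (∼-trans {rep p} {p} (∼-sym {p} (∼rep p)) (∼-trans {p} {q} p∼q (∼rep q)))

    rep-invariant : ∀ {g} → G g → ∀ p → rep (act g p) ≡ rep p
    rep-invariant g∈G p = sym (rep-resp {p} (_ , g∈G , refl))

    rep-fixes-C : ∀ {c} → C c → rep c ≡ c
    rep-fixes-C {c} c∈C = unique (rep∈C c) c∈C (∼-sym {p = c} (∼rep c))

module Pairing {c ℓ} (R : CommutativeRing c ℓ) where
  open Over R
  open CommutativeRing R renaming (Carrier to A)
  open IntegerCoefficientRingSolver R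
  open import Algebra.Properties.Ring ring using (x∙y⁻¹≈ε⇒x≈y)
  open import Relation.Binary.Reasoning.Setoid setoid

  ⟪_,_⟫ : (P1 → A) → Div → A
  ⟪ f , [] ⟫          = 0#
  ⟪ f , (p , r) ∷ d ⟫ = r * f p + ⟪ f , d ⟫

  ⟪⟫-++ : ∀ f d d′ → ⟪ f , d ++ d′ ⟫ ≈ ⟪ f , d ⟫ + ⟪ f , d′ ⟫
  ⟪⟫-++ f []            d′ = sym (+-identityˡ _)
  ⟪⟫-++ f ((p , r) ∷ d) d′ = trans (+-congˡ (⟪⟫-++ f d d′)) (sym (+-assoc _ _ _))

  ⟪⟫-negD : ∀ f d → ⟪ f , negD d ⟫ ≈ - ⟪ f , d ⟫
  ⟪⟫-negD f []            = solve 0 (con (+ 0) := :- con (+ 0)) refl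
  ⟪⟫-negD f ((p , r) ∷ d) = begin
    - r * f p + ⟪ f , negD d ⟫  ≈⟨ +-congˡ (⟪⟫-negD f d) ⟩
    - r * f p + - ⟪ f , d ⟫     ≈⟨ solve 3 (λ r x y → :- r :* x :+ :- y := :- (r :* x :+ y)) refl r (f p) ⟪ f , d ⟫ ⟩
    - (r * f p + ⟪ f , d ⟫)     ∎

  ⟪⟫--D : ∀ f d d′ → ⟪ f , d -D d′ ⟫ ≈ ⟪ f , d ⟫ - ⟪ f , d′ ⟫
  ⟪⟫--D f d d′ = trans (⟪⟫-++ f d (negD d′)) (+-congˡ (⟪⟫-negD f d′))

  ⟪⟫-actD : ∀ f g d → ⟪ f , actD g d ⟫ ≡ ⟪ f ∘ act g , d ⟫
  ⟪⟫-actD f g []            = ≡.refl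
  ⟪⟫-actD f g ((p , r) ∷ d) = ≡.cong (λ t → r * f (act g p) + t) (⟪⟫-actD f g d)

  ⟪⟫-symbol : ∀ f s v w → ⟪ f , scaleD s [ v , w ] ⟫ ≈ s * (f w - f v)
  ⟪⟫-symbol f s v w =
    solve 3 (λ s x y → s :* con (+ 1) :* x :+ (s :* :- con (+ 1) :* y :+ con (+ 0)) := s :* (x :- y)) refl s (f w) (f v)

  relSum-++ : ∀ l l′ → relSum (l ++ l′) ≡ relSum l ++ relSum l′
  relSum-++ []            l′ = ≡.refl
  relSum-++ ((g , m) ∷ l) l′ = ≡.trans (≡.cong ((actD g m -D m) ++_) (relSum-++ l l′)) (≡.sym (List.++-assoc (actD g m -D m) (relSum l) (relSum l′)))

  ⟪⟫-relSum-∷ : ∀ f g m l → ⟪ f , relSum ((g , m) ∷ l) ⟫ ≈ (⟪ f ∘ act g , m ⟫ - ⟪ f , m ⟫) + ⟪ f , relSum l ⟫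
  ⟪⟫-relSum-∷ f g m l = begin
    ⟪ f , (actD g m -D m) ++ relSum l ⟫               ≈⟨ ⟪⟫-++ f (actD g m -D m) (relSum l) ⟩
    ⟪ f , actD g m -D m ⟫ + ⟪ f , relSum l ⟫          ≈⟨ +-congʳ (⟪⟫--D f (actD g m) m) ⟩
    (⟪ f , actD g m ⟫ - ⟪ f , m ⟫) + ⟪ f , relSum l ⟫ ≡⟨ ≡.cong (λ t → (t - ⟪ f , m ⟫) + ⟪ f , relSum l ⟫) (⟪⟫-actD f g m) ⟩
    (⟪ f ∘ act g , m ⟫ - ⟪ f , m ⟫) + ⟪ f , relSum l ⟫ ∎

  ⟪⟫-congˡ : ∀ {f f′} → (∀ p → f p ≡ f′ p) → ∀ d → ⟪ f , d ⟫ ≡ ⟪ f′ , d ⟫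
  ⟪⟫-congˡ f≗f′ []            = ≡.refl
  ⟪⟫-congˡ f≗f′ ((p , r) ∷ d) = ≡.cong₂ (λ x y → r * x + y) (f≗f′ p) (⟪⟫-congˡ f≗f′ d)

  Invariant : (P1 → A) → Mat2 → Set c
  Invariant f g = ∀ p → f (act g p) ≡ f p

  ⟪⟫-relSum-invariant : ∀ f l → All (Invariant f ∘ proj₁) l → ⟪ f , relSum l ⟫ ≈ 0#
  ⟪⟫-relSum-invariant f []            []             = refl
  ⟪⟫-relSum-invariant f ((g , m) ∷ l) (f-inv ∷ l-inv) = begin
    ⟪ f , relSum ((g , m) ∷ l) ⟫                      ≈⟨ ⟪⟫-relSum-∷ f g m l ⟩
    (⟪ f ∘ act g , m ⟫ - ⟪ f , m ⟫) + ⟪ f , relSum l ⟫ ≡⟨ ≡.cong (λ t → (t - ⟪ f , m ⟫) + ⟪ f , relSum l ⟫) (⟪⟫-congˡ f-inv m) ⟩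
    (⟪ f , m ⟫ - ⟪ f , m ⟫) + ⟪ f , relSum l ⟫        ≈⟨ +-cong (-‿inverseʳ _) (⟪⟫-relSum-invariant f l l-inv) ⟩
    0# + 0#                                           ≈⟨ +-identityʳ 0# ⟩
    0#                                                ∎

  deg-symbol : ∀ s v w → InSt (scaleD s [ v , w ])
  deg-symbol s v w = solve 1 (λ s → s :* con (+ 1) :+ (s :* :- con (+ 1) :+ con (+ 0)) := con (+ 0)) refl s

  deg-++ : ∀ d d′ → deg (d ++ d′) ≈ deg d + deg d′
  deg-++ []            d′ = sym (+-identityˡ _)
  deg-++ ((p , r) ∷ d) d′ = trans (+-congˡ (deg-++ d d′)) (sym (+-assoc _ _ _))

  δ : P1 → P1 → A
  δ p q with q ≟P p
  ... | yes _ = 1#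
  ... | no _  = 0#

  coeff-⟪⟫ : ∀ d p → coeff d p ≈ ⟪ δ p , d ⟫
  coeff-⟪⟫ []            p = refl
  coeff-⟪⟫ ((q , r) ∷ d) p with q ≟P p
  ... | yes _ = +-cong (sym (*-identityʳ r)) (coeff-⟪⟫ d p)
  ... | no _  = trans (coeff-⟪⟫ d p) (sym (trans (+-congʳ (zeroʳ r)) (+-identityˡ _)))

  ≈D-intro : ∀ d d′ → (∀ f → ⟪ f , d ⟫ ≈ ⟪ f , d′ ⟫) → d ≈D d′
  ≈D-intro d d′ ⟪⟫-≈ p = begin
    coeff d p       ≈⟨ coeff-⟪⟫ d p ⟩
    ⟪ δ p , d ⟫     ≈⟨ ⟪⟫-≈ (δ p) ⟩
    ⟪ δ p , d′ ⟫    ≈⟨ coeff-⟪⟫ d′ p ⟨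
    coeff d′ p      ∎

  coeff-∷-≢ : ∀ {q p} r d → q ≢ p → coeff ((q , r) ∷ d) p ≈ coeff d p
  coeff-∷-≢ {q} {p} r d q≢p with q ≟P p
  ... | yes q≡p = ⊥-elim (q≢p q≡p)
  ... | no _    = refl

  erase : P1 → Div → Div
  erase q []            = []
  erase q ((p , r) ∷ d) with p ≟P q
  ... | yes _ = erase q d
  ... | no _  = (p , r) ∷ erase q d

  length-erase : ∀ q d → length (erase q d) ≤ length d
  length-erase q []            = z≤n
  length-erase q ((p , r) ∷ d) with p ≟P q
  ... | yes _ = ℕ.m≤n⇒m≤1+n (length-erase q d)
  ... | no _  = s≤s (length-erase q d)

  coeff-erase-≡ : ∀ q d → coeff (erase q d) q ≈ 0#
  coeff-erase-≡ q []            = refl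
  coeff-erase-≡ q ((p , r) ∷ d) with p ≟P q
  ... | yes _   = coeff-erase-≡ q d
  ... | no p≢q  = trans (coeff-∷-≢ r (erase q d) p≢q) (coeff-erase-≡ q d)

  coeff-erase-≢ : ∀ {q p} d → q ≢ p → coeff (erase q d) p ≈ coeff d p
  coeff-erase-≢ {q} {p} []             q≢p = refl
  coeff-erase-≢ {q} {p} ((p′ , r) ∷ d) q≢p with p′ ≟P q
  ... | yes ≡.refl = trans (coeff-erase-≢ d q≢p) (sym (coeff-∷-≢ r d q≢p))
  ... | no _ with p′ ≟P p
  ...   | yes _ = +-congˡ (coeff-erase-≢ d q≢p)
  ...   | no _  = coeff-erase-≢ d q≢p

  ⟪⟫-erase : ∀ f q d → ⟪ f , d ⟫ ≈ coeff d q * f q + ⟪ f , erase q d ⟫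
  ⟪⟫-erase f q []            = solve 1 (λ x → con (+ 0) := con (+ 0) :* x :+ con (+ 0)) refl (f q)
  ⟪⟫-erase f q ((p , r) ∷ d) with p ≟P q
  ... | yes ≡.refl = begin
    r * f p + ⟪ f , d ⟫                                ≈⟨ +-congˡ (⟪⟫-erase f p d) ⟩
    r * f p + (coeff d p * f p + ⟪ f , erase p d ⟫)    ≈⟨ solve 4 (λ r c x y → r :* x :+ (c :* x :+ y) := (r :+ c) :* x :+ y) refl r (coeff d p) (f p) ⟪ f , erase p d ⟫ ⟩
    (r + coeff d p) * f p + ⟪ f , erase p d ⟫          ∎
  ... | no _ = begin
    r * f p + ⟪ f , d ⟫                                ≈⟨ +-congˡ (⟪⟫-erase f q d) ⟩
    r * f p + (coeff d q * f q + ⟪ f , erase q d ⟫)    ≈⟨ solve 4 (λ x c y z → x :+ (c :* y :+ z) := c :* y :+ (x :+ z)) refl (r * f p) (coeff d q) (f q) ⟪ f , erase q d ⟫ ⟩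
    coeff d q * f q + (r * f p + ⟪ f , erase q d ⟫)    ∎

  -- A point may occur several times in a divisor, so the induction is on the length and
  -- erases all occurrences of a point at once.
  ⟪⟫-vanishes : ∀ f d → (∀ p → coeff d p ≈ 0#) → ⟪ f , d ⟫ ≈ 0#
  ⟪⟫-vanishes f d = go (length d) d ℕ.≤-refl
    where
    go : ∀ n d → length d ≤ n → (∀ p → coeff d p ≈ 0#) → ⟪ f , d ⟫ ≈ 0#
    go n       []            _           _      = refl
    go (suc n) ((q , r) ∷ d) (s≤s |d|≤n) d≈0 = begin
      ⟪ f , (q , r) ∷ d ⟫                                                 ≈⟨ ⟪⟫-erase f q ((q , r) ∷ d) ⟩
      coeff ((q , r) ∷ d) q * f q + ⟪ f , erase q ((q , r) ∷ d) ⟫         ≈⟨ +-cong (*-congʳ (d≈0 q)) (go n (erase q ((q , r) ∷ d)) (erase-shorter |d|≤n) erase-vanishes) ⟩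
      0# * f q + 0#                                                       ≈⟨ trans (+-identityʳ _) (zeroˡ (f q)) ⟩
      0#                                                                  ∎
      where
      erase-shorter : length d ≤ n → length (erase q ((q , r) ∷ d)) ≤ n
      erase-shorter |d|≤n with q ≟P q
      ... | yes _   = ℕ.≤-trans (length-erase q d) |d|≤n
      ... | no q≢q  = ⊥-elim (q≢q ≡.refl)
      erase-vanishes : ∀ p → coeff (erase q ((q , r) ∷ d)) p ≈ 0#
      erase-vanishes p with q ≟P p
      ... | yes ≡.refl = coeff-erase-≡ q ((q , r) ∷ d)
      ... | no q≢p     = trans (coeff-erase-≢ ((q , r) ∷ d) q≢p) (d≈0 p)

  ⟪⟫-cong : ∀ f d d′ → d ≈D d′ → ⟪ f , d ⟫ ≈ ⟪ f , d′ ⟫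
  ⟪⟫-cong f d d′ d≈d′ = x∙y⁻¹≈ε⇒x≈y _ _ (begin
    ⟪ f , d ⟫ - ⟪ f , d′ ⟫   ≈⟨ ⟪⟫--D f d d′ ⟨
    ⟪ f , d -D d′ ⟫          ≈⟨ ⟪⟫-vanishes f (d -D d′) d-d′≈0 ⟩
    0#                       ∎)
    where
    d-d′≈0 : ∀ p → coeff (d -D d′) p ≈ 0#
    d-d′≈0 p = begin
      coeff (d -D d′) p               ≈⟨ coeff-⟪⟫ (d -D d′) p ⟩
      ⟪ δ p , d -D d′ ⟫               ≈⟨ ⟪⟫--D (δ p) d d′ ⟩
      ⟪ δ p , d ⟫ - ⟪ δ p , d′ ⟫      ≈⟨ +-cong (coeff-⟪⟫ d p) (-‿cong (coeff-⟪⟫ d′ p)) ⟨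
      coeff d p - coeff d′ p          ≈⟨ +-congʳ (d≈d′ p) ⟩
      coeff d′ p - coeff d′ p         ≈⟨ -‿inverseʳ _ ⟩
      0#                              ∎

module Coinvariants {c ℓ} (R : CommutativeRing c ℓ) where
  open Over R
  open CommutativeRing R
  open IntegerCoefficientRingSolver R
  open Pairing R
  open import Relation.Binary.Reasoning.Setoid setoid

  ⟪⟫-relation : ∀ f x y l → (x -D y) ≈D relSum l → ⟪ f , x ⟫ - ⟪ f , y ⟫ ≈ ⟪ f , relSum l ⟫
  ⟪⟫-relation f x y l x-y≈l = trans (sym (⟪⟫--D f x y)) (⟪⟫-cong f (x -D y) (relSum l) x-y≈l)

  -- The content of _≡St[_]_ and _≡D[_]_ (see ≡mod⇒Σ), as a record so that its endpoints
  -- can be inferred.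
  record _≡mod[_]_ {p} (x : Div) (P : Mat2 × Div → Set p) (y : Div) : Set (c ⊔ ℓ ⊔ p) where
    constructor mk≡mod
    field
      relations   : List (Mat2 × Div)
      relations∈P : All P relations
      x-y≈relSum  : (x -D y) ≈D relSum relations

  module _ {p} {P : Mat2 × Div → Set p} where

    ≡mod⇒Σ : ∀ {x y} → x ≡mod[ P ] y → Σ (List (Mat2 × Div)) λ l → All P l × ((x -D y) ≈D relSum l)
    ≡mod⇒Σ (mk≡mod l l∈P x-y≈l) = l , l∈P , x-y≈l

    Σ⇒≡mod : ∀ x y → (Σ (List (Mat2 × Div)) λ l → All P l × ((x -D y) ≈D relSum l)) → x ≡mod[ P ] y
    Σ⇒≡mod x y (l , l∈P , x-y≈l) = mk≡mod l l∈P x-y≈l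

    ≡mod-intro : ∀ {x y} l → All P l → (∀ f → ⟪ f , x ⟫ - ⟪ f , y ⟫ ≈ ⟪ f , relSum l ⟫) → x ≡mod[ P ] y
    ≡mod-intro {x} {y} l l∈P ⟪⟫-≈ = mk≡mod l l∈P (≈D-intro (x -D y) (relSum l) (λ f → trans (⟪⟫--D f x y) (⟪⟫-≈ f)))

    ≈D⇒≡mod : ∀ x y → x ≈D y → x ≡mod[ P ] y
    ≈D⇒≡mod x y x≈y = ≡mod-intro [] [] λ f → begin
      ⟪ f , x ⟫ - ⟪ f , y ⟫   ≈⟨ +-congʳ (⟪⟫-cong f x y x≈y) ⟩
      ⟪ f , y ⟫ - ⟪ f , y ⟫   ≈⟨ -‿inverseʳ _ ⟩
      0#                      ∎

    ≡mod-refl : ∀ x → x ≡mod[ P ] x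
    ≡mod-refl x = ≈D⇒≡mod x x (λ _ → refl)

    ≡mod-trans : ∀ {x y z} → x ≡mod[ P ] y → y ≡mod[ P ] z → x ≡mod[ P ] z
    ≡mod-trans {x} {y} {z} (mk≡mod l l∈P x-y≈l) (mk≡mod l′ l′∈P y-z≈l′) =
      ≡mod-intro (l ++ l′) (All.++⁺ l∈P l′∈P) λ f → begin
        ⟪ f , x ⟫ - ⟪ f , z ⟫                                   ≈⟨ solve 3 (λ x y z → x :- z := (x :- y) :+ (y :- z)) refl ⟪ f , x ⟫ ⟪ f , y ⟫ ⟪ f , z ⟫ ⟩
        (⟪ f , x ⟫ - ⟪ f , y ⟫) + (⟪ f , y ⟫ - ⟪ f , z ⟫)       ≈⟨ +-cong (⟪⟫-relation f x y l x-y≈l) (⟪⟫-relation f y z l′ y-z≈l′) ⟩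
        ⟪ f , relSum l ⟫ + ⟪ f , relSum l′ ⟫                    ≈⟨ ⟪⟫-++ f (relSum l) (relSum l′) ⟨
        ⟪ f , relSum l ++ relSum l′ ⟫                           ≡⟨ ≡.cong ⟪ f ,_⟫ (relSum-++ l l′) ⟨
        ⟪ f , relSum (l ++ l′) ⟫                                ∎

    ≡mod-++ : ∀ {x x′ y y′} → x ≡mod[ P ] y → x′ ≡mod[ P ] y′ → (x ++ x′) ≡mod[ P ] (y ++ y′)
    ≡mod-++ {x} {x′} {y} {y′} (mk≡mod l l∈P x-y≈l) (mk≡mod l′ l′∈P x′-y′≈l′) =
      ≡mod-intro (l ++ l′) (All.++⁺ l∈P l′∈P) λ f → begin
        ⟪ f , x ++ x′ ⟫ - ⟪ f , y ++ y′ ⟫                       ≈⟨ +-cong (⟪⟫-++ f x x′) (-‿cong (⟪⟫-++ f y y′)) ⟩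
        (⟪ f , x ⟫ + ⟪ f , x′ ⟫) - (⟪ f , y ⟫ + ⟪ f , y′ ⟫)     ≈⟨ solve 4 (λ x x′ y y′ → (x :+ x′) :- (y :+ y′) := (x :- y) :+ (x′ :- y′))
                                                                           refl ⟪ f , x ⟫ ⟪ f , x′ ⟫ ⟪ f , y ⟫ ⟪ f , y′ ⟫ ⟩
        (⟪ f , x ⟫ - ⟪ f , y ⟫) + (⟪ f , x′ ⟫ - ⟪ f , y′ ⟫)     ≈⟨ +-cong (⟪⟫-relation f x y l x-y≈l) (⟪⟫-relation f x′ y′ l′ x′-y′≈l′) ⟩
        ⟪ f , relSum l ⟫ + ⟪ f , relSum l′ ⟫                    ≈⟨ ⟪⟫-++ f (relSum l) (relSum l′) ⟨
        ⟪ f , relSum l ++ relSum l′ ⟫                           ≡⟨ ≡.cong ⟪ f ,_⟫ (relSum-++ l l′) ⟨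
        ⟪ f , relSum (l ++ l′) ⟫                                ∎

    ≡mod-sym : (∀ {g m} → P (g , m) → P (g , negD m)) → ∀ {x y} → x ≡mod[ P ] y → y ≡mod[ P ] x
    ≡mod-sym P-negD {x} {y} (mk≡mod l l∈P x-y≈l) = ≡mod-intro (map negate l) (All.map⁺ (All.map P-negD l∈P)) λ f → begin
        ⟪ f , y ⟫ - ⟪ f , x ⟫                ≈⟨ solve 2 (λ x y → y :- x := :- (x :- y)) refl ⟪ f , x ⟫ ⟪ f , y ⟫ ⟩
        - (⟪ f , x ⟫ - ⟪ f , y ⟫)            ≈⟨ -‿cong (⟪⟫-relation f x y l x-y≈l) ⟩
        - ⟪ f , relSum l ⟫                   ≈⟨ ⟪⟫-relSum-negate f l ⟨
        ⟪ f , relSum (map negate l) ⟫        ∎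
      where
      negate : Mat2 × Div → Mat2 × Div
      negate (g , m) = g , negD m
      ⟪⟫-relSum-negate : ∀ f l → ⟪ f , relSum (map negate l) ⟫ ≈ - ⟪ f , relSum l ⟫
      ⟪⟫-relSum-negate f []            = solve 0 (con (+ 0) := :- con (+ 0)) refl
      ⟪⟫-relSum-negate f ((g , m) ∷ l) = begin
        ⟪ f , relSum ((g , negD m) ∷ map negate l) ⟫
          ≈⟨ ⟪⟫-relSum-∷ f g (negD m) (map negate l) ⟩
        (⟪ f ∘ act g , negD m ⟫ - ⟪ f , negD m ⟫) + ⟪ f , relSum (map negate l) ⟫
          ≈⟨ +-cong (+-cong (⟪⟫-negD (f ∘ act g) m) (-‿cong (⟪⟫-negD f m))) (⟪⟫-relSum-negate f l) ⟩
        (- ⟪ f ∘ act g , m ⟫ - - ⟪ f , m ⟫) + - ⟪ f , relSum l ⟫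
          ≈⟨ solve 3 (λ x y z → (:- x :- :- y) :+ :- z := :- ((x :- y) :+ z)) refl ⟪ f ∘ act g , m ⟫ ⟪ f , m ⟫ ⟪ f , relSum l ⟫ ⟩
        - ((⟪ f ∘ act g , m ⟫ - ⟪ f , m ⟫) + ⟪ f , relSum l ⟫)
          ≈⟨ -‿cong (⟪⟫-relSum-∷ f g m l) ⟨
        - ⟪ f , relSum ((g , m) ∷ l) ⟫
          ∎

    ≡mod-mono : ∀ {q} {Q : Mat2 × Div → Set q} → (∀ {gm} → P gm → Q gm) → ∀ {x y} → x ≡mod[ P ] y → x ≡mod[ Q ] y
    ≡mod-mono P⇒Q (mk≡mod l l∈P x-y≈l) = mk≡mod l (All.map P⇒Q l∈P) x-y≈l

module CuspidalDecomposition {c ℓ} (R : CommutativeRing c ℓ) {G : Mat2 → Set} (G≤GL₂ : IsSubgroupGL2 G)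
                {C : P1 → Set} (C-reps : IsOrbitReps G C) where
  open Over R
  open CommutativeRing R renaming (Carrier to A)
  open IntegerCoefficientRingSolver R
  open Pairing R
  open Coinvariants R
  open SubgroupAction G≤GL₂
  open Representatives C-reps
  open IsOrbitReps C-reps using (contains-e)
  open import Relation.Binary.Reasoning.Setoid setoid

  spanV∈St : ∀ l → InSt (spanV l)
  spanV∈St []            = refl
  spanV∈St ((r , g) ∷ l) = begin
    deg (scaleD r [ e , act g e ] ++ spanV l)        ≈⟨ deg-++ (scaleD r [ e , act g e ]) (spanV l) ⟩
    deg (scaleD r [ e , act g e ]) + deg (spanV l)   ≈⟨ +-cong (deg-symbol r e (act g e)) (spanV∈St l) ⟩
    0# + 0#                                          ≈⟨ +-identityʳ 0# ⟩
    0#                                               ∎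

  symbolRelation : A × Mat2 → Mat2 × Div
  symbolRelation (r , g) = g , (e , r) ∷ []

  ⟪⟫-spanV : ∀ f l → ⟪ f , spanV l ⟫ ≈ ⟪ f , relSum (map symbolRelation l) ⟫
  ⟪⟫-spanV f []            = refl
  ⟪⟫-spanV f ((r , g) ∷ l) = begin
    ⟪ f , scaleD r [ e , act g e ] ++ spanV l ⟫                             ≈⟨ ⟪⟫-++ f (scaleD r [ e , act g e ]) (spanV l) ⟩
    ⟪ f , scaleD r [ e , act g e ] ⟫ + ⟪ f , spanV l ⟫                      ≈⟨ +-cong (⟪⟫-symbol f r e (act g e)) (⟪⟫-spanV f l) ⟩
    r * (f (act g e) - f e) + rest                                          ≈⟨ +-congʳ (solve 3 (λ r x y → r :* (x :- y) := (r :* x :+ con (+ 0)) :- (r :* y :+ con (+ 0))) refl r (f (act g e)) (f e)) ⟩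
    ((r * f (act g e) + 0#) - (r * f e + 0#)) + rest                        ≈⟨ ⟪⟫-relSum-∷ f g ((e , r) ∷ []) (map symbolRelation l) ⟨
    ⟪ f , relSum (map symbolRelation ((r , g) ∷ l)) ⟫                       ∎
    where rest = ⟪ f , relSum (map symbolRelation l) ⟫

  spanV-cusp : ∀ l → All (G ∘ proj₂) l → spanV l ≡mod[ G ∘ proj₁ ] []
  spanV-cusp l l∈G = ≡mod-intro (map symbolRelation l) (All.map⁺ l∈G) λ f →
    trans (solve 1 (λ x → x :- con (+ 0) := x) refl ⟪ f , spanV l ⟫) (⟪⟫-spanV f l)

  toRep : P1 → Mat2
  toRep q = proj₁ (∼rep q)

  toRep∈G : ∀ q → G (toRep q)
  toRep∈G q = proj₁ (proj₂ (∼rep q))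

  act-toRep : ∀ q → act (toRep q) q ≡.≡ rep q
  act-toRep q = proj₂ (proj₂ (∼rep q))

  -- r (q) = r [e, rep q] − r [e, g e] + (g m − m) + r (e)  for  g = toRep q,  m = −r [e, q]
  ⟪⟫-point : ∀ f q r → r * f q ≈
    (⟪ f , scaleD (- r) [ e , act (toRep q) e ] ⟫ + ⟪ f , scaleD r [ e , rep q ] ⟫)
    + ((⟪ f ∘ act (toRep q) , scaleD (- r) [ e , q ] ⟫ - ⟪ f , scaleD (- r) [ e , q ] ⟫) + r * f e)
  ⟪⟫-point f q r = begin
    r * f q
      ≈⟨ solve 5 (λ r fq fe fge fρ →
                    r :* fq := (:- r :* (fge :- fe) :+ r :* (fρ :- fe))
                               :+ ((:- r :* (fρ :- fge) :- :- r :* (fq :- fe)) :+ r :* fe))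
                 refl r (f q) (f e) (f ge) (f (rep q)) ⟩
    (- r * (f ge - f e) + r * (f (rep q) - f e)) + ((- r * (f (rep q) - f ge) - - r * (f q - f e)) + r * f e)
      ≈⟨ +-cong (+-cong (⟪⟫-symbol f (- r) e ge) (⟪⟫-symbol f r e (rep q)))
                (+-congʳ (+-cong gm≈ (-‿cong (⟪⟫-symbol f (- r) e q)))) ⟨
    (⟪ f , scaleD (- r) [ e , ge ] ⟫ + ⟪ f , scaleD r [ e , rep q ] ⟫)
      + ((⟪ f ∘ act g , scaleD (- r) [ e , q ] ⟫ - ⟪ f , scaleD (- r) [ e , q ] ⟫) + r * f e) ∎
    where
    g  = toRep q
    ge = act g e
    gm≈ : ⟪ f ∘ act g , scaleD (- r) [ e , q ] ⟫ ≈ - r * (f (rep q) - f ge)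
    gm≈ = trans (⟪⟫-symbol (f ∘ act g) (- r) e q) (reflexive (≡.cong (λ t → - r * (f t - f ge)) (act-toRep q)))

  vPart : Div → List (A × Mat2)
  vPart = map (λ (q , r) → - r , toRep q)

  wPart : Div → List (A × P1)
  wPart = map (λ (q , r) → r , rep q)

  relPart : Div → List (Mat2 × Div)
  relPart = map (λ (q , r) → toRep q , scaleD (- r) [ e , q ])

  ⟪⟫-decomposition : ∀ f x →
    ⟪ f , x ⟫ - (⟪ f , spanV (vPart x) ⟫ + ⟪ f , spanW (wPart x) ⟫) ≈ ⟪ f , relSum (relPart x) ⟫ + deg x * f e
  ⟪⟫-decomposition f []            = solve 1 (λ x → con (+ 0) :- (con (+ 0) :+ con (+ 0)) := con (+ 0) :+ con (+ 0) :* x) refl (f e)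
  ⟪⟫-decomposition f ((q , r) ∷ x) = begin
    (r * f q + X) - (⟪ f , v₀ ++ spanV (vPart x) ⟫ + ⟪ f , w₀ ++ spanW (wPart x) ⟫)
      ≈⟨ +-cong (+-congʳ (⟪⟫-point f q r)) (-‿cong (+-cong (⟪⟫-++ f v₀ (spanV (vPart x))) (⟪⟫-++ f w₀ (spanW (wPart x))))) ⟩
    (((V₀ + W₀) + (M - M′ + r * f e)) + X) - ((V₀ + V) + (W₀ + W))
      ≈⟨ solve 8 (λ V₀ W₀ M M′ re X V W → (((V₀ :+ W₀) :+ (M :- M′ :+ re)) :+ X) :- ((V₀ :+ V) :+ (W₀ :+ W)) := (M :- M′) :+ ((X :- (V :+ W)) :+ re)) refl V₀ W₀ M M′ (r * f e) X V W ⟩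
    (M - M′) + ((X - (V + W)) + r * f e)
      ≈⟨ +-congˡ (+-congʳ (⟪⟫-decomposition f x)) ⟩
    (M - M′) + ((⟪ f , relSum (relPart x) ⟫ + deg x * f e) + r * f e)
      ≈⟨ solve 6 (λ m m′ L D fe r → (m :- m′) :+ ((L :+ D :* fe) :+ r :* fe) := ((m :- m′) :+ L) :+ (r :+ D) :* fe) refl M M′ ⟪ f , relSum (relPart x) ⟫ (deg x) (f e) r ⟩
    ((M - M′) + ⟪ f , relSum (relPart x) ⟫) + (r + deg x) * f e
      ≈⟨ +-congʳ (⟪⟫-relSum-∷ f (toRep q) m (relPart x)) ⟨
    ⟪ f , relSum (relPart ((q , r) ∷ x)) ⟫ + (r + deg x) * f e ∎
    where
    v₀ = scaleD (- r) [ e , act (toRep q) e ]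
    w₀ = scaleD r [ e , rep q ]
    m  = scaleD (- r) [ e , q ]
    X  = ⟪ f , x ⟫
    V  = ⟪ f , spanV (vPart x) ⟫
    W  = ⟪ f , spanW (wPart x) ⟫
    V₀ = ⟪ f , v₀ ⟫
    W₀ = ⟪ f , w₀ ⟫
    M  = ⟪ f ∘ act (toRep q) , m ⟫
    M′ = ⟪ f , m ⟫

  vPart∈G : ∀ x → All (G ∘ proj₂) (vPart x)
  vPart∈G x = All.map⁺ (All.universal (λ (q , r) → toRep∈G q) x)

  wPart∈C : ∀ x → All (C ∘ proj₂) (wPart x)
  wPart∈C x = All.map⁺ (All.universal (λ (q , r) → rep∈C q) x)

  decomposition : ∀ x → InSt x → x ≡mod[ (λ gm → G (proj₁ gm) × InSt (proj₂ gm)) ] (spanV (vPart x) ++ spanW (wPart x))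
  decomposition x x∈St = ≡mod-intro (relPart x) relPart∈ λ f → begin
    ⟪ f , x ⟫ - ⟪ f , y ++ w ⟫                  ≈⟨ +-congˡ (-‿cong (⟪⟫-++ f y w)) ⟩
    ⟪ f , x ⟫ - (⟪ f , y ⟫ + ⟪ f , w ⟫)         ≈⟨ ⟪⟫-decomposition f x ⟩
    ⟪ f , relSum (relPart x) ⟫ + deg x * f e    ≈⟨ +-congˡ (trans (*-congʳ x∈St) (zeroˡ (f e))) ⟩
    ⟪ f , relSum (relPart x) ⟫ + 0#             ≈⟨ +-identityʳ _ ⟩
    ⟪ f , relSum (relPart x) ⟫                  ∎
    where
    y = spanV (vPart x)
    w = spanW (wPart x)
    relPart∈ : All (λ gm → G (proj₁ gm) × InSt (proj₂ gm)) (relPart x)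
    relPart∈ = All.map⁺ (All.universal (λ (q , r) → toRep∈G q , deg-symbol (- r) e q) x)

  ⟪⟫-spanW-rep : ∀ f l → All (C ∘ proj₂) l → ⟪ f ∘ rep , spanW l ⟫ ≡.≡ ⟪ f , spanW l ⟫
  ⟪⟫-spanW-rep f []             []          = ≡.refl
  ⟪⟫-spanW-rep f ((r , c′) ∷ l) (c′∈C ∷ l∈C) =
    ≡.cong₂ (λ u t → r * 1# * f u + t) (rep-fixes-C c′∈C)
      (≡.cong₂ (λ u t → r * - 1# * f u + t) (rep-fixes-C contains-e) (⟪⟫-spanW-rep f l l∈C))

  spanW-vanishes : ∀ l → All (C ∘ proj₂) l → spanW l ≡mod[ G ∘ proj₁ ] [] → spanW l ≈D []
  spanW-vanishes l l∈C (mk≡mod rels rels∈G w≈rels) = ≈D-intro (spanW l) [] λ f → begin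
    ⟪ f , spanW l ⟫                                  ≡⟨ ⟪⟫-spanW-rep f l l∈C ⟨
    ⟪ f ∘ rep , spanW l ⟫                            ≈⟨ solve 1 (λ x → x := x :- con (+ 0)) refl _ ⟩
    ⟪ f ∘ rep , spanW l ⟫ - ⟪ f ∘ rep , [] ⟫         ≈⟨ ⟪⟫-relation (f ∘ rep) (spanW l) [] rels w≈rels ⟩
    ⟪ f ∘ rep , relSum rels ⟫                        ≈⟨ ⟪⟫-relSum-invariant (f ∘ rep) rels (All.map (λ g∈G p → ≡.cong f (rep-invariant g∈G p)) rels∈G) ⟩
    0#                                               ∎

  V⇒cusp : ∀ x → (Σ (List (A × Mat2)) λ l → All (G ∘ proj₂) l × (x ≡St[ G ] spanV l)) → Cusp G x
  V⇒cusp x (l , l∈G , x≡V) = ≡mod⇒Σ (≡mod-trans (≡mod-mono proj₁ (Σ⇒≡mod x (spanV l) x≡V)) (spanV-cusp l l∈G))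

  cusp⇒V : ∀ x → InSt x → Cusp G x → Σ (List (A × Mat2)) λ l → All (G ∘ proj₂) l × (x ≡St[ G ] spanV l)
  cusp⇒V x x∈St x∈cusp = vPart x , vPart∈G x , ≡mod⇒Σ (≡mod-trans (decomposition x x∈St) y+w≡y)
    where
    y = spanV (vPart x)
    w = spanW (wPart x)
    w-cusp : w ≡mod[ G ∘ proj₁ ] []
    w-cusp = ≡mod-trans (≡mod-++ (≡mod-sym id (spanV-cusp (vPart x) (vPart∈G x))) (≡mod-refl w))
               (≡mod-trans (≡mod-sym id (≡mod-mono proj₁ (decomposition x x∈St))) (Σ⇒≡mod x [] x∈cusp))
    y+w≡y : (y ++ w) ≡mod[ (λ gm → G (proj₁ gm) × InSt (proj₂ gm)) ] y
    y+w≡y = ≡.subst (λ z → (y ++ w) ≡mod[ _ ] z) (List.++-identityʳ y)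
              (≡mod-++ (≡mod-refl y) (≈D⇒≡mod w [] (spanW-vanishes (wPart x) (wPart∈C x) w-cusp)))

lemma5p4 : ∀ {c ℓ} (R : CommutativeRing c ℓ) (G : Mat2 → Set) → IsSubgroupGL2 G
  → (C : P1 → Set) → IsOrbitReps G C
  → let open Over R
        open CommutativeRing R using (Carrier)
    in
    -- H₀(G,St) = H₀^cusp + W
    ((∀ x → InSt x → Σ Div λ y → Σ (List (Carrier × P1)) λ l →
        InSt y × Cusp G y × All (λ rp → C (proj₂ rp)) l
        × (x ≡St[ G ] (y ++ spanW l)))
    -- H₀^cusp ∩ W = 0
    × (∀ (l : List (Carrier × P1)) → All (λ rp → C (proj₂ rp)) l
        → Cusp G (spanW l) → spanW l ≡St[ G ] []))
    -- H₀^cusp = V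
    × (∀ x → InSt x → (Cusp G x ⇔ (Σ (List (Carrier × Mat2)) λ l →
        All (λ rg → G (proj₂ rg)) l × (x ≡St[ G ] spanV l))))
lemma5p4 R G G≤GL₂ C C-reps =
  ( (λ x x∈St → spanV (vPart x) , wPart x , spanV∈St (vPart x) , ≡mod⇒Σ (spanV-cusp (vPart x) (vPart∈G x))
                , wPart∈C x , ≡mod⇒Σ (decomposition x x∈St))
  , λ l l∈C w-cusp → ≡mod⇒Σ (≈D⇒≡mod (spanW l) [] (spanW-vanishes l l∈C (Σ⇒≡mod (spanW l) [] w-cusp))) )
  , λ x x∈St → mk⇔ (cusp⇒V x x∈St) (V⇒cusp x)
  where
  open CuspidalDecomposition R G≤GL₂ C-reps
  open Over R
  open Coinvariants R
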